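{- Let $G$ be a graph and $P$ a finite set of colors. Fix a partial strong edge-coloring of $G$ with colors from $P$, and let $T$ be the set of uncolored edges. For $e\in T$, let $A(e)\subseteq P$ be the set of colors not used on any colored edge that shares an endpoint with $e$ or is joined to $e$ by an edge. For $S\subseteq T$ define $\mathrm{disc}(S)=|S|-\left|\bigcup_{e\in S}A(e)\right|$. Let $S\subseteq T$ be a subset of maximum discrepancy. Then every assignment of colors from $P$ to the edges of $S$ that yields a partial strong edge-coloring can be extended to a strong edge-coloring of all of $G$ with colors from $P$ (i.e., to all edges of $T$).
   Context: A strong edge-coloring is an assignment of colors to edges such that any two distinct edges that share an endpoint, or that are joined by an edge, receive different colors. A partial strong edge-coloring is such an assignment defined on a subset of the edges, satisfying these conditions among the colored edges. -}

module Defs where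

open import Data.Nat using (ℕ)
open import Data.Integer using (ℤ; _⊖_; _≤_)
open import Data.Fin using (Fin; _≟_)
open import Data.Fin.Properties using (any?; all?)
open import Data.Fin.Subset using (Subset; _∈_; _⊆_; ∣_∣)
open import Data.Fin.Subset.Properties using (_∈?_)
open import Data.Maybe using (Maybe; just; nothing)
import Data.Maybe.Properties as MaybeP
open import Data.Product using (Σ; ∃; _×_; _,_)
open import Data.Sum using (_⊎_)
open import Data.Vec using (tabulate)
open import Relation.Nullary using (¬_; Dec; yes; no; does)
open import Relation.Nullary.Decidable using (_×-dec_; _⊎-dec_; ¬?)
open import Relation.Binary.PropositionalEquality using (_≡_; _≢_)

record Graph : Set where
  field
    n m      : ℕ
    src tgt  : Fin m → Fin n
    loopless : ∀ e → src e ≢ tgt e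
    simple   : ∀ e f →
               ((src e ≡ src f × tgt e ≡ tgt f) ⊎ (src e ≡ tgt f × tgt e ≡ src f)) →
               e ≡ f

module _ (G : Graph) where
  open Graph G

  Incident : Fin n → Fin m → Set
  Incident v e = v ≡ src e ⊎ v ≡ tgt e

  ShareEnd : Fin m → Fin m → Set
  ShareEnd e f = Incident (src e) f ⊎ Incident (tgt e) f

  Joined : Fin m → Fin m → Set
  Joined e f = ∃ λ g → (Incident (src g) e × Incident (tgt g) f)
                     ⊎ (Incident (tgt g) e × Incident (src g) f)

  Conflict : Fin m → Fin m → Set
  Conflict e f = e ≢ f × (ShareEnd e f ⊎ Joined e f)

  -- partial edge-colourings with colour set P = Fin k (nothing = uncoloured)
  PartialColoring : ℕ → Set
  PartialColoring k = Fin m → Maybe (Fin k)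

  IsPartialStrong : ∀ {k} → PartialColoring k → Set
  IsPartialStrong c = ∀ e f x → Conflict e f → c e ≡ just x → c f ≡ just x → Data.Empty.⊥
    where import Data.Empty

  IsStrong : ∀ {k} → (Fin m → Fin k) → Set
  IsStrong χ = ∀ e f → Conflict e f → χ e ≢ χ f

  incident? : ∀ v e → Dec (Incident v e)
  incident? v e = (v ≟ src e) ⊎-dec (v ≟ tgt e)

  conflict? : ∀ e f → Dec (Conflict e f)
  conflict? e f = ¬? (e ≟ f) ×-dec
    ((incident? (src e) f ⊎-dec incident? (tgt e) f) ⊎-dec
     any? (λ g → (incident? (src g) e ×-dec incident? (tgt g) f)
              ⊎-dec (incident? (tgt g) e ×-dec incident? (src g) f)))

  module _ {k : ℕ} (c : PartialColoring k) where

    Uncolored : Subset m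
    Uncolored = tabulate λ e → does (MaybeP.≡-dec _≟_ (c e) nothing)

    Available : Fin m → Fin k → Set
    Available e p = ∀ f → Conflict e f → c f ≢ just p

    available? : ∀ e p → Dec (Available e p)
    available? e p = all? λ f → conflict? e f Relation.Nullary.Decidable.→-dec
                                 ¬? (MaybeP.≡-dec _≟_ (c f) (just p))
      where import Relation.Nullary.Decidable

    UnionA : Subset m → Subset k
    UnionA S = tabulate λ p → does (any? λ e → (e ∈? S) ×-dec available? e p)

    disc : Subset m → ℤ
    disc S = ∣ S ∣ ⊖ ∣ UnionA S ∣

    MaxDisc : Subset m → Set
    MaxDisc S = S ⊆ Uncolored × (∀ S′ → S′ ⊆ Uncolored → disc S′ ≤ disc S)

    extendOn : (S : Subset m) → ((e : Fin m) → e ∈ S → Fin k) → PartialColoring k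
    extendOn S φ e with e ∈? S
    ... | yes e∈S = just (φ e e∈S)
    ... | no _    = c e

-- Let U = ⋃_{e∈S} A(e). Every colour φ puts on an edge of S is available for that edge, hence
-- lies in U. Maximality of disc(S) applied to S′ ∪ S, for S′ ⊆ T ∖ S, gives
-- |S′| ≤ |⋃_{e∈S′} A(e) ∖ U|: this is Hall's condition for colouring the edges of T ∖ S with
-- pairwise distinct colours from A(e) ∖ U. Hall's theorem provides such a colouring, and it
-- conflicts neither with c (the colours are available) nor with φ (they avoid U).
module Submission where

open import Defs
open import Data.Nat using (ℕ)
open import Data.Fin using (Fin)
open import Data.Fin.Subset using (Subset; _∈_)
open import Data.Maybe using (just)
open import Data.Product using (Σ; _×_)
open import Relation.Binary.PropositionalEquality using (_≡_)

open import Data.Nat using (zero; suc; _+_; _≤_; _<_; z≤n; s≤s⁻¹; _≤?_; _<?_)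
import Data.Nat.Properties as ℕ
open import Data.Fin using (_≟_)
open import Data.Fin.Properties using (any?)
open import Data.Fin.Subset using (_⊆_; _∪_; _─_; ⁅_⁆; ∣_∣; Nonempty; Empty; _∉_; inside; outside)
open import Data.Fin.Subset.Properties
  using (_∈?_; _⊆?_; nonempty?; anySubset?; ⊆-trans; p⊆q⇒∣p∣≤∣q∣; p─q⊆p; ∣p─q∣≤∣p∣;
         x∈p∧x∉q⇒x∈p─q; x∈p∪q⁻; p⊆p∪q; q⊆p∪q; ∣p∣≤∣p∪q∣; x∈⁅x⁆; x∈⁅y⁆⇒x≡y; ∣⁅x⁆∣≡1; Empty-unique; ∣⊥∣≡0;
         p∩q≢∅⇒∣p─q∣<∣p∣; x∈p∩q⁺)
open import Data.Vec.Base using ([]; _∷_; tabulate; there)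
open import Data.Vec.Properties using (lookup∘tabulate; []=⇒lookup; lookup⇒[]=)
open import Data.Maybe using (Maybe; nothing)
open import Data.Maybe.Properties using (just-injective; ≡-dec)
import Data.Integer as ℤ
import Data.Integer.Properties as ℤP
open import Data.Empty using (⊥)
open import Data.Integer.Solver using (module +-*-Solver)
open import Data.Product using (∃; _,_; proj₁; proj₂)
open import Data.Sum using (_⊎_; inj₁; inj₂)
open import Function using (_∘_)
open import Relation.Nullary using (Dec; yes; no; does; contradiction)
open import Relation.Nullary.Decidable using (_×-dec_; ¬?; dec-true)
open import Relation.Binary.PropositionalEquality using (_≢_; refl; sym; trans; cong; subst)

private
  variable
    n : ℕ

tabulate-does⁻ : ∀ {P : Fin n → Set} (P? : ∀ x → Dec (P x)) {x} →
                 x ∈ tabulate (does ∘ P?) → P x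
tabulate-does⁻ P? {x} x∈ with P? x | trans (sym (lookup∘tabulate (does ∘ P?) x)) ([]=⇒lookup x∈)
... | yes px | _  = px
... | no  _  | ()

tabulate-does⁺ : ∀ {P : Fin n → Set} (P? : ∀ x → Dec (P x)) {x} →
                 P x → x ∈ tabulate (does ∘ P?)
tabulate-does⁺ P? {x} px =
  lookup⇒[]= x (tabulate (does ∘ P?)) (trans (lookup∘tabulate (does ∘ P?) x) (dec-true (P? x) px))

x∈p─q⇒x∉q : ∀ (p q : Subset n) {x} → x ∈ p ─ q → x ∉ q
x∈p─q⇒x∉q (_ ∷ p) (inside ∷ q)  (there x∈) (there x∈q) = x∈p─q⇒x∉q p q x∈ x∈q
x∈p─q⇒x∉q (_ ∷ p) (outside ∷ q) (there x∈) (there x∈q) = x∈p─q⇒x∉q p q x∈ x∈q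

∪-⊆ : ∀ {p q r : Subset n} → p ⊆ r → q ⊆ r → p ∪ q ⊆ r
∪-⊆ {p = p} {q = q} p⊆r q⊆r x∈ with x∈p∪q⁻ p q x∈
... | inj₁ x∈p = p⊆r x∈p
... | inj₂ x∈q = q⊆r x∈q

∣p∪q∣≡∣p─q∣+∣q∣ : ∀ (p q : Subset n) → ∣ p ∪ q ∣ ≡ ∣ p ─ q ∣ + ∣ q ∣
∣p∪q∣≡∣p─q∣+∣q∣ [] [] = refl
∣p∪q∣≡∣p─q∣+∣q∣ (outside ∷ p) (outside ∷ q) = ∣p∪q∣≡∣p─q∣+∣q∣ p q
∣p∪q∣≡∣p─q∣+∣q∣ (inside ∷ p)  (outside ∷ q) = cong suc (∣p∪q∣≡∣p─q∣+∣q∣ p q)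
∣p∪q∣≡∣p─q∣+∣q∣ (outside ∷ p) (inside ∷ q)  =
  trans (cong suc (∣p∪q∣≡∣p─q∣+∣q∣ p q)) (sym (ℕ.+-suc _ _))
∣p∪q∣≡∣p─q∣+∣q∣ (inside ∷ p)  (inside ∷ q)  =
  trans (cong suc (∣p∪q∣≡∣p─q∣+∣q∣ p q)) (sym (ℕ.+-suc _ _))

∣p∪q∣≡∣p∣+∣q∣ : ∀ {p q : Subset n} → (∀ {x} → x ∈ p → x ∉ q) → ∣ p ∪ q ∣ ≡ ∣ p ∣ + ∣ q ∣
∣p∪q∣≡∣p∣+∣q∣ {p = p} {q = q} disjoint = trans (∣p∪q∣≡∣p─q∣+∣q∣ p q) (cong (_+ ∣ q ∣) ∣p─q∣≡∣p∣)
  where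
  ∣p─q∣≡∣p∣ : ∣ p ─ q ∣ ≡ ∣ p ∣
  ∣p─q∣≡∣p∣ = ℕ.≤-antisym (∣p─q∣≤∣p∣ p q)
                (p⊆q⇒∣p∣≤∣q∣ (λ x∈p → x∈p∧x∉q⇒x∈p─q x∈p (disjoint x∈p)))

Empty⇒∣p∣≡0 : ∀ {n} {p : Subset n} → Empty p → ∣ p ∣ ≡ 0
Empty⇒∣p∣≡0 {n} empty = trans (cong ∣_∣ (Empty-unique empty)) (∣⊥∣≡0 n)

0<∣p∣⇒Nonempty : ∀ (p : Subset n) → 0 < ∣ p ∣ → Nonempty p
0<∣p∣⇒Nonempty p 0<∣p∣ with nonempty? p
... | yes ne   = ne
... | no empty = contradiction (subst (0 <_) (Empty⇒∣p∣≡0 empty) 0<∣p∣) λ ()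

module _ {m k : ℕ} where

  Neighbourhood : {Γ : Fin m → Fin k → Set} → (∀ e p → Dec (Γ e p)) → Subset m → Subset k
  Neighbourhood Γ? S = tabulate λ p → does (any? λ e → (e ∈? S) ×-dec Γ? e p)

  module _ {Γ : Fin m → Fin k → Set} (Γ? : ∀ e p → Dec (Γ e p)) {S : Subset m} where

    ∈-Neighbourhood⁺ : ∀ {e p} → e ∈ S → Γ e p → p ∈ Neighbourhood Γ? S
    ∈-Neighbourhood⁺ {e} e∈S γ = tabulate-does⁺ (λ p → any? _) (e , e∈S , γ)

    ∈-Neighbourhood⁻ : ∀ {p} → p ∈ Neighbourhood Γ? S → ∃ λ e → e ∈ S × Γ e p
    ∈-Neighbourhood⁻ = tabulate-does⁻ (λ p → any? _)

  Without : (Fin m → Fin k → Set) → Subset k → Fin m → Fin k → Set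
  Without Γ Y e p = Γ e p × p ∉ Y

  without? : {Γ : Fin m → Fin k → Set} → (∀ e p → Dec (Γ e p)) →
             (Y : Subset k) → ∀ e p → Dec (Without Γ Y e p)
  without? Γ? Y e p = Γ? e p ×-dec ¬? (p ∈? Y)

  HallCondition : {Γ : Fin m → Fin k → Set} → (∀ e p → Dec (Γ e p)) → Subset m → Set
  HallCondition Γ? T = ∀ S → S ⊆ T → ∣ S ∣ ≤ ∣ Neighbourhood Γ? S ∣

  record Matching (Γ : Fin m → Fin k → Set) (T : Subset m) : Set where
    field
      match           : ∀ e → e ∈ T → Fin k
      match-valid     : ∀ e (e∈T : e ∈ T) → Γ e (match e e∈T)
      match-injective : ∀ {e f} (e∈T : e ∈ T) (f∈T : f ∈ T) →
                        match e e∈T ≡ match f f∈T → e ≡ f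

  open Matching

  module _ {Γ : Fin m → Fin k → Set} where

    emptyMatching : ∀ {T} → Empty T → Matching Γ T
    emptyMatching empty = record
      { match           = λ e e∈T → contradiction (e , e∈T) empty
      ; match-valid     = λ e e∈T → contradiction (e , e∈T) empty
      ; match-injective = λ {e} e∈T _ _ → contradiction (e , e∈T) empty
      }

    singletonMatching : ∀ {e p} → Γ e p → Matching Γ ⁅ e ⁆
    singletonMatching {e} {p} γ = record
      { match           = λ _ _ → p
      ; match-valid     = λ f f∈ → subst (λ x → Γ x p) (sym (x∈⁅y⁆⇒x≡y e f∈)) γ
      ; match-injective = λ f∈ g∈ _ → trans (x∈⁅y⁆⇒x≡y e f∈) (sym (x∈⁅y⁆⇒x≡y e g∈))
      }

    combine : ∀ {S T Y} (M : Matching Γ S) → (∀ e e∈S → match M e e∈S ∈ Y) →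
              Matching (Without Γ Y) (T ─ S) → Matching Γ T
    combine {S} {T} {Y} M M∈Y M′ = record
      { match = μ ; match-valid = μ-valid ; match-injective = μ-injective }
      where
      μ : ∀ e → e ∈ T → Fin k
      μ e e∈T with e ∈? S
      ... | yes e∈S = match M e e∈S
      ... | no  e∉S = match M′ e (x∈p∧x∉q⇒x∈p─q e∈T e∉S)

      μ-valid : ∀ e e∈T → Γ e (μ e e∈T)
      μ-valid e e∈T with e ∈? S
      ... | yes e∈S = match-valid M e e∈S
      ... | no  _   = proj₁ (match-valid M′ e _)

      μ-injective : ∀ {e f} e∈T f∈T → μ e e∈T ≡ μ f f∈T → e ≡ f
      μ-injective {e} {f} e∈T f∈T eq with e ∈? S | f ∈? S
      ... | yes e∈S | yes f∈S = match-injective M e∈S f∈S eq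
      ... | no  _   | no  _   = match-injective M′ _ _ eq
      ... | yes e∈S | no  _   = contradiction (subst (_∈ Y) eq (M∈Y e e∈S)) (proj₂ (match-valid M′ f _))
      ... | no  _   | yes f∈S = contradiction (subst (_∈ Y) (sym eq) (M∈Y f f∈S)) (proj₂ (match-valid M′ e _))

  module _ {Γ : Fin m → Fin k → Set} (Γ? : ∀ e p → Dec (Γ e p)) where

    private
      N = Neighbourhood Γ?

    Neighbourhood-∪ : ∀ S′ S → N (S′ ∪ S) ⊆ N S′ ∪ N S
    Neighbourhood-∪ S′ S p∈ with ∈-Neighbourhood⁻ Γ? p∈
    ... | e , e∈ , γ with x∈p∪q⁻ S′ S e∈
    ...   | inj₁ e∈S′ = p⊆p∪q (N S) (∈-Neighbourhood⁺ Γ? e∈S′ γ)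
    ...   | inj₂ e∈S  = q⊆p∪q (N S′) (N S) (∈-Neighbourhood⁺ Γ? e∈S γ)

    Neighbourhood-─ : ∀ S Y → N S ─ Y ⊆ Neighbourhood (without? Γ? Y) S
    Neighbourhood-─ S Y p∈ with ∈-Neighbourhood⁻ Γ? (p─q⊆p (N S) Y p∈)
    ... | e , e∈S , γ = ∈-Neighbourhood⁺ (without? Γ? Y) e∈S (γ , x∈p─q⇒x∉q (N S) Y p∈)

    ∣Neighbourhood∪∣≤ : ∀ S Y → ∣ N S ∪ Y ∣ ≤ ∣ Neighbourhood (without? Γ? Y) S ∣ + ∣ Y ∣
    ∣Neighbourhood∪∣≤ S Y = ℕ.≤-trans (ℕ.≤-reflexive (∣p∪q∣≡∣p─q∣+∣q∣ (N S) Y))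
      (ℕ.+-monoˡ-≤ ∣ Y ∣ (p⊆q⇒∣p∣≤∣q∣ (Neighbourhood-─ S Y)))

    HallCondition-⊆ : ∀ {S T} → HallCondition Γ? T → S ⊆ T → HallCondition Γ? S
    HallCondition-⊆ hall S⊆T S′ S′⊆S = hall S′ (⊆-trans S′⊆S S⊆T)

    HallCondition⇒∃ : ∀ {T e} → HallCondition Γ? T → e ∈ T → ∃ (Γ e)
    HallCondition⇒∃ {T} {e} hall e∈T =
      colour (∈-Neighbourhood⁻ Γ? (proj₂ (0<∣p∣⇒Nonempty (N ⁅ e ⁆) 0<∣N⁅e⁆∣)))
      where
      0<∣N⁅e⁆∣ : 0 < ∣ N ⁅ e ⁆ ∣
      0<∣N⁅e⁆∣ = ℕ.≤-trans (ℕ.≤-reflexive (sym (∣⁅x⁆∣≡1 e)))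
                   (hall ⁅ e ⁆ λ f∈ → subst (_∈ T) (sym (x∈⁅y⁆⇒x≡y e f∈)) e∈T)
      colour : ∀ {p} → (∃ λ f → f ∈ ⁅ e ⁆ × Γ f p) → ∃ (Γ e)
      colour (f , f∈ , γ) = _ , subst (λ x → Γ x _) (x∈⁅y⁆⇒x≡y e f∈) γ

    -- The hypothesis says |S′ ∪ S| − |N (S′ ∪ S)| ≤ |S| − |N S|, moved so as to avoid subtraction.
    hall-contract : ∀ {T S} →
      (∀ S′ → S′ ⊆ T ─ S → ∣ S′ ∪ S ∣ + ∣ N S ∣ ≤ ∣ S ∣ + ∣ N (S′ ∪ S) ∣) →
      HallCondition (without? Γ? (N S)) (T ─ S)
    hall-contract {T} {S} deficiency S′ S′⊆ =
      ℕ.+-cancelʳ-≤ ∣ S ∣ _ _ (ℕ.+-cancelʳ-≤ ∣ N S ∣ _ _ (begin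
        ∣ S′ ∣ + ∣ S ∣ + ∣ N S ∣       ≡⟨ cong (_+ ∣ N S ∣) (∣p∪q∣≡∣p∣+∣q∣ disjoint) ⟨
        ∣ S′ ∪ S ∣ + ∣ N S ∣           ≤⟨ deficiency S′ S′⊆ ⟩
        ∣ S ∣ + ∣ N (S′ ∪ S) ∣         ≤⟨ ℕ.+-monoʳ-≤ ∣ S ∣ neighbours ⟩
        ∣ S ∣ + (∣ N′ S′ ∣ + ∣ N S ∣)  ≡⟨ ℕ.+-assoc ∣ S ∣ _ _ ⟨
        ∣ S ∣ + ∣ N′ S′ ∣ + ∣ N S ∣    ≡⟨ cong (_+ ∣ N S ∣) (ℕ.+-comm ∣ S ∣ _) ⟩
        ∣ N′ S′ ∣ + ∣ S ∣ + ∣ N S ∣    ∎))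
      where
      open ℕ.≤-Reasoning
      N′ = Neighbourhood (without? Γ? (N S))
      disjoint : ∀ {x} → x ∈ S′ → x ∉ S
      disjoint x∈ = x∈p─q⇒x∉q T S (S′⊆ x∈)
      neighbours : ∣ N (S′ ∪ S) ∣ ≤ ∣ N′ S′ ∣ + ∣ N S ∣
      neighbours = ℕ.≤-trans (p⊆q⇒∣p∣≤∣q∣ (Neighbourhood-∪ S′ S)) (∣Neighbourhood∪∣≤ S′ (N S))

    hall-surplus : ∀ {T p} → (∀ S → S ⊆ T → Nonempty S → ∣ S ∣ < ∣ N S ∣) →
                   HallCondition (without? Γ? ⁅ p ⁆) T
    hall-surplus {T} {p} surplus S S⊆T with nonempty? S
    ... | no empty = ℕ.≤-trans (ℕ.≤-reflexive (Empty⇒∣p∣≡0 empty)) z≤n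
    ... | yes ne   = ℕ.+-cancelʳ-≤ 1 _ _ (begin
      ∣ S ∣ + 1             ≡⟨ ℕ.+-comm ∣ S ∣ 1 ⟩
      suc ∣ S ∣             ≤⟨ surplus S S⊆T ne ⟩
      ∣ N S ∣               ≤⟨ ∣p∣≤∣p∪q∣ (N S) ⁅ p ⁆ ⟩
      ∣ N S ∪ ⁅ p ⁆ ∣       ≤⟨ ∣Neighbourhood∪∣≤ S ⁅ p ⁆ ⟩
      ∣ N′ S ∣ + ∣ ⁅ p ⁆ ∣  ≡⟨ cong (∣ N′ S ∣ +_) (∣⁅x⁆∣≡1 p) ⟩
      ∣ N′ S ∣ + 1          ∎)
      where
      open ℕ.≤-Reasoning
      N′ = Neighbourhood (without? Γ? ⁅ p ⁆)

  Critical : {Γ : Fin m → Fin k → Set} → (∀ e p → Dec (Γ e p)) → Subset m → Subset m → Set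
  Critical Γ? T S = S ⊆ T × Nonempty S × ∣ S ∣ < ∣ T ∣ × ∣ Neighbourhood Γ? S ∣ ≤ ∣ S ∣

  critical? : {Γ : Fin m → Fin k → Set} (Γ? : ∀ e p → Dec (Γ e p)) → ∀ T S → Dec (Critical Γ? T S)
  critical? Γ? T S = (S ⊆? T) ×-dec (nonempty? S ×-dec ((∣ S ∣ <? ∣ T ∣) ×-dec (∣ Neighbourhood Γ? S ∣ ≤? ∣ S ∣)))

  -- Either a critical S splits the problem into S and T ─ S with the colours of N S removed,
  -- or every proper nonempty subset has surplus and any one edge can be matched first.
  hall-bounded : ∀ b {Γ : Fin m → Fin k → Set} (Γ? : ∀ e p → Dec (Γ e p)) T →
                 ∣ T ∣ < b → HallCondition Γ? T → Matching Γ T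
  hall-bounded zero Γ? T () _
  hall-bounded (suc b) Γ? T ∣T∣<1+b hall with anySubset? (critical? Γ? T)
  ... | yes (S , S⊆T , (x , x∈S) , ∣S∣<∣T∣ , tight) =
    combine M (λ e e∈S → ∈-Neighbourhood⁺ Γ? e∈S (match-valid M e e∈S)) M′
    where
    M = hall-bounded b Γ? S (ℕ.<-≤-trans ∣S∣<∣T∣ (s≤s⁻¹ ∣T∣<1+b)) (HallCondition-⊆ Γ? hall S⊆T)
    deficiency : ∀ S′ → S′ ⊆ T ─ S →
                 ∣ S′ ∪ S ∣ + ∣ Neighbourhood Γ? S ∣ ≤ ∣ S ∣ + ∣ Neighbourhood Γ? (S′ ∪ S) ∣
    deficiency S′ S′⊆ = ℕ.≤-trans
      (ℕ.+-mono-≤ (hall (S′ ∪ S) (∪-⊆ (⊆-trans S′⊆ (p─q⊆p T S)) S⊆T)) tight)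
      (ℕ.≤-reflexive (ℕ.+-comm _ ∣ S ∣))
    ∣T─S∣<∣T∣ = p∩q≢∅⇒∣p─q∣<∣p∣ T S (x , x∈p∩q⁺ (S⊆T x∈S , x∈S))
    M′ = hall-bounded b (without? Γ? (Neighbourhood Γ? S)) (T ─ S)
           (ℕ.<-≤-trans ∣T─S∣<∣T∣ (s≤s⁻¹ ∣T∣<1+b)) (hall-contract Γ? deficiency)
  ... | no ¬critical with nonempty? T
  ...   | no empty = emptyMatching empty
  ...   | yes (e , e∈T) =
    combine (singletonMatching (proj₂ colour)) (λ _ _ → x∈⁅x⁆ (proj₁ colour)) M′
    where
    colour = HallCondition⇒∃ Γ? hall e∈T
    ∣T─e∣<∣T∣ = p∩q≢∅⇒∣p─q∣<∣p∣ T ⁅ e ⁆ (e , x∈p∩q⁺ (e∈T , x∈⁅x⁆ e))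
    surplus : ∀ S → S ⊆ T ─ ⁅ e ⁆ → Nonempty S → ∣ S ∣ < ∣ Neighbourhood Γ? S ∣
    surplus S S⊆ ne = ℕ.≰⇒> λ tight →
      ¬critical (S , ⊆-trans S⊆ (p─q⊆p T _) , ne , ℕ.≤-<-trans (p⊆q⇒∣p∣≤∣q∣ S⊆) ∣T─e∣<∣T∣ , tight)
    M′ = hall-bounded b (without? Γ? ⁅ proj₁ colour ⁆) (T ─ ⁅ e ⁆)
           (ℕ.<-≤-trans ∣T─e∣<∣T∣ (s≤s⁻¹ ∣T∣<1+b)) (hall-surplus Γ? surplus)

  hall : {Γ : Fin m → Fin k → Set} (Γ? : ∀ e p → Dec (Γ e p)) {T : Subset m} →
         HallCondition Γ? T → Matching Γ T
  hall Γ? {T} = hall-bounded (suc ∣ T ∣) Γ? T ℕ.≤-refl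

module _ {m : ℕ} {A : Set} (d : Fin m → Maybe A) (g : ∀ e → d e ≡ nothing → A) where

  complete-at : ∀ e o → d e ≡ o → A
  complete-at e (just x) _   = x
  complete-at e nothing  de≡ = g e de≡

  complete : Fin m → A
  complete e = complete-at e (d e) refl

  complete-just : ∀ {e x} → d e ≡ just x → complete e ≡ x
  complete-just {e} = at (d e) refl
    where
    at : ∀ {x} o (de≡ : d e ≡ o) → o ≡ just x → complete-at e o de≡ ≡ x
    at (just y) _ refl = refl

  complete-view : ∀ e → (∃ λ x → d e ≡ just x × complete e ≡ x)
                        ⊎ (∃ λ (de≡ : d e ≡ nothing) → complete e ≡ g e de≡)
  complete-view e = at (d e) refl
    where
    at : ∀ o (de≡ : d e ≡ o) → (∃ λ x → d e ≡ just x × complete-at e o de≡ ≡ x)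
                               ⊎ (∃ λ (de≡′ : d e ≡ nothing) → complete-at e o de≡ ≡ g e de≡′)
    at (just x) de≡ = inj₁ (x , de≡ , refl)
    at nothing  de≡ = inj₂ (de≡ , refl)

m⊖n≤o⊖p⇒m+p≤o+n : ∀ m n o p → m ℤ.⊖ n ℤ.≤ o ℤ.⊖ p → m + p ≤ o + n
m⊖n≤o⊖p⇒m+p≤o+n m n o p m⊖n≤o⊖p = ℤP.drop‿+≤+ (begin
  ℤ.+ (m + p)                          ≡⟨ shift m n p ⟨
  (m ℤ.⊖ n) ℤ.+ (ℤ.+ n ℤ.+ ℤ.+ p)        ≤⟨ ℤP.+-monoˡ-≤ (ℤ.+ n ℤ.+ ℤ.+ p) m⊖n≤o⊖p ⟩
  (o ℤ.⊖ p) ℤ.+ (ℤ.+ n ℤ.+ ℤ.+ p)        ≡⟨ cong (λ z → (o ℤ.⊖ p) ℤ.+ z) (ℤP.+-comm (ℤ.+ n) (ℤ.+ p)) ⟩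
  (o ℤ.⊖ p) ℤ.+ (ℤ.+ p ℤ.+ ℤ.+ n)        ≡⟨ shift o p n ⟩
  ℤ.+ (o + n)                          ∎)
  where
  open ℤP.≤-Reasoning
  open +-*-Solver
  shift : ∀ a b c → (a ℤ.⊖ b) ℤ.+ (ℤ.+ b ℤ.+ ℤ.+ c) ≡ ℤ.+ (a + c)
  shift a b c = trans (cong (λ z → z ℤ.+ (ℤ.+ b ℤ.+ ℤ.+ c)) (sym (ℤP.m-n≡m⊖n a b)))
    (solve 3 (λ x y z → (x :- y) :+ (y :+ z) := x :+ z) refl (ℤ.+ a) (ℤ.+ b) (ℤ.+ c))

Conflict-sym : ∀ (G : Graph) {e f} → Conflict G e f → Conflict G f e
Conflict-sym G (e≢f , inj₁ shared)                = e≢f ∘ sym , inj₁ (ShareEnd-sym shared)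
  where
  ShareEnd-sym : ∀ {e f} → ShareEnd G e f → ShareEnd G f e
  ShareEnd-sym (inj₁ (inj₁ eq)) = inj₁ (inj₁ (sym eq))
  ShareEnd-sym (inj₁ (inj₂ eq)) = inj₂ (inj₁ (sym eq))
  ShareEnd-sym (inj₂ (inj₁ eq)) = inj₁ (inj₂ (sym eq))
  ShareEnd-sym (inj₂ (inj₂ eq)) = inj₂ (inj₂ (sym eq))
Conflict-sym G (e≢f , inj₂ (g , inj₁ (ge , gf))) = e≢f ∘ sym , inj₂ (g , inj₂ (gf , ge))
Conflict-sym G (e≢f , inj₂ (g , inj₂ (ge , gf))) = e≢f ∘ sym , inj₂ (g , inj₁ (gf , ge))

module Extension (G : Graph) {k : ℕ} (c : PartialColoring G k)
                 (S : Subset (Graph.m G)) (maxDisc : MaxDisc G c S)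
                 (φ : (e : Fin (Graph.m G)) → e ∈ S → Fin k)
                 (ext-strong : IsPartialStrong G (extendOn G c S φ)) where

  open Graph G using (m)
  open Matching

  private
    ext = extendOn G c S φ
    T   = Uncolored G c
    U   = UnionA G c S
    free? = without? (available? G c) U

  uncolored⁻ : ∀ {e} → e ∈ T → c e ≡ nothing
  uncolored⁻ = tabulate-does⁻ (λ e → ≡-dec _≟_ (c e) nothing)

  uncolored⁺ : ∀ {e} → c e ≡ nothing → e ∈ T
  uncolored⁺ = tabulate-does⁺ (λ e → ≡-dec _≟_ (c e) nothing)

  extendOn-outside : ∀ {e} → e ∉ S → ext e ≡ c e
  extendOn-outside {e} e∉S with e ∈? S
  ... | yes e∈S = contradiction e∈S e∉S
  ... | no  _   = refl

  extendOn-nothing : ∀ {e} → ext e ≡ nothing → e ∈ T ─ S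
  extendOn-nothing {e} ext≡ with e ∈? S
  ... | yes _   = contradiction ext≡ λ ()
  ... | no  e∉S = x∈p∧x∉q⇒x∈p─q (uncolored⁺ ext≡) e∉S

  extendOn-available : ∀ {f x} → f ∈ S → ext f ≡ just x → Available G c f x
  extendOn-available {f} {x} f∈S ext≡ g conflict cg≡ =
    ext-strong f g x conflict ext≡ (trans (extendOn-outside g∉S) cg≡)
    where
    g∉S : g ∉ S
    g∉S g∈S = contradiction (trans (sym (uncolored⁻ (proj₁ maxDisc g∈S))) cg≡) λ ()

  maximal-deficiency : ∀ S′ → S′ ⊆ T ─ S → ∣ S′ ∪ S ∣ + ∣ U ∣ ≤ ∣ S ∣ + ∣ UnionA G c (S′ ∪ S) ∣
  maximal-deficiency S′ S′⊆ =
    m⊖n≤o⊖p⇒m+p≤o+n (∣ S′ ∪ S ∣) (∣ UnionA G c (S′ ∪ S) ∣) (∣ S ∣) (∣ U ∣)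
      (proj₂ maxDisc (S′ ∪ S) (∪-⊆ (⊆-trans S′⊆ (p─q⊆p T S)) (proj₁ maxDisc)))

  M : Matching (Without (Available G c) U) (T ─ S)
  M = hall free? (hall-contract (available? G c) maximal-deficiency)

  χ : Fin m → Fin k
  χ = complete ext (λ e ext≡ → match M e (extendOn-nothing ext≡))

  matched-colour-free : ∀ {e f} (e∈ : e ∈ T ─ S) → Conflict G e f → ext f ≢ just (match M e e∈)
  matched-colour-free {e} {f} e∈ conflict ext≡ = by-cases (f ∈? S)
    where
    by-cases : Dec (f ∈ S) → ⊥
    by-cases (yes f∈S) = proj₂ (match-valid M e e∈)
      (∈-Neighbourhood⁺ (available? G c) f∈S (extendOn-available f∈S ext≡))
    by-cases (no f∉S)  = proj₁ (match-valid M e e∈) f conflict (trans (sym (extendOn-outside f∉S)) ext≡)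

  χ-strong : IsStrong G χ
  χ-strong e f conflict χe≡χf with complete-view ext _ e | complete-view ext _ f
  ... | inj₁ (x , ext-e , χe≡x) | inj₁ (y , ext-f , χf≡y) =
    ext-strong e f x conflict ext-e (trans ext-f (cong just (trans (sym χf≡y) (trans (sym χe≡χf) χe≡x))))
  ... | inj₂ (_ , χe≡) | inj₂ (_ , χf≡) =
    proj₁ conflict (match-injective M _ _ (trans (sym χe≡) (trans χe≡χf χf≡)))
  ... | inj₂ (_ , χe≡) | inj₁ (y , ext-f , χf≡y) =
    matched-colour-free _ conflict (trans ext-f (cong just (trans (sym χf≡y) (trans (sym χe≡χf) χe≡))))
  ... | inj₁ (x , ext-e , χe≡x) | inj₂ (_ , χf≡) =
    matched-colour-free _ (Conflict-sym G conflict) (trans ext-e (cong just (trans (sym χe≡x) (trans χe≡χf χf≡))))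

  χ-extends : ∀ e x → ext e ≡ just x → χ e ≡ x
  χ-extends e x = complete-just ext _ {e}

lemma9 : (G : Graph) (k : ℕ) (c : PartialColoring G k) →
           IsPartialStrong G c →
           (S : Subset (Graph.m G)) → MaxDisc G c S →
           (φ : (e : Fin (Graph.m G)) → e ∈ S → Fin k) →
           IsPartialStrong G (extendOn G c S φ) →
           Σ (Fin (Graph.m G) → Fin k) λ χ →
             IsStrong G χ × (∀ e x → extendOn G c S φ e ≡ just x → χ e ≡ x)
-- The hypothesis IsPartialStrong G c is implied by the one on its extension.
lemma9 G k c _ S maxDisc φ ext-strong = χ , χ-strong , χ-extends
  where open Extension G c S maxDisc φ ext-strong
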